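{- Let $S$ be a Steiner triple system of order $n$ with $n>3$. The following are equivalent: (1) $\beta(S)=\frac{1}{3}\binom{n}{2}$; (2) $\alpha(S)=\frac{1}{3}\binom{n}{2}$; (3) $S$ is isomorphic to the projective geometry $PG(k,2)$ (points and lines of the projective space of dimension $k$ over the field with two elements) for some $k\geq 2$.
   Context: A Steiner triple system of order $n$ is a pair $(X,S)$ with $|X|=n$ and $S$ a set of 3-subsets of $X$ (blocks) such that every pair of distinct elements of $X$ lies in exactly one block. The associated quasigroup operation: $a\star a=a$ and for $a\neq b$, $a\star b$ is the third element of the block containing $a,b$. Define $A(S)=\{\{a\star b,b\star c,c\star a\} : a,b,c\in X \text{ distinct}, \{a,b,c\}\notin S\}$, $B(S)=\{\{a\star b,b\star c,c\star a\} : a,b,c\in X \text{ distinct}\}$, $\alpha(S)=|A(S)|$, $\beta(S)=|B(S)|$. -}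

module Defs where

open import Data.Bool using (Bool; true; false; _xor_)
import Data.Bool.Properties as BoolP
open import Data.Nat using (ℕ; zero; suc)
open import Data.Fin using (Fin)
open import Data.Fin.Properties using (any?) renaming (_≟_ to _≟ᶠ_)
open import Data.Fin.Subset using (Subset; ⁅_⁆; _∪_; ∣_∣; _∈_)
open import Data.Vec using (Vec; []; _∷_; replicate; zipWith)
open import Data.Vec.Properties using (≡-dec)
open import Data.List using (List; []; _∷_; map; _++_; filter; length)
open import Data.Product using (Σ; ∃; _×_; _,_; proj₁)
open import Relation.Nullary using (¬_; Dec; yes; no)
open import Relation.Nullary.Decidable using (_×-dec_; ¬?)
open import Relation.Binary.PropositionalEquality using (_≡_; _≢_)

triple : ∀ {n} → Fin n → Fin n → Fin n → Subset n
triple a b c = ⁅ a ⁆ ∪ ⁅ b ⁆ ∪ ⁅ c ⁆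

record STS (n : ℕ) : Set where
  field
    isBlock    : Subset n → Bool
    blockSize  : ∀ T → isBlock T ≡ true → ∣ T ∣ ≡ 3
    pairUnique : ∀ a b → a ≢ b →
                 Σ (Subset n) λ T → isBlock T ≡ true × a ∈ T × b ∈ T ×
                   (∀ T′ → isBlock T′ ≡ true → a ∈ T′ → b ∈ T′ → T′ ≡ T)

module _ {n : ℕ} (S : STS n) where
  open STS S

  -- the associated quasigroup: a ⋆ a = a, and for a ≠ b, a ⋆ b is the third
  -- point of the block through a and b (found by search; the fallback `a`
  -- never occurs for a ≠ b by the STS axioms)
  _⋆_ : Fin n → Fin n → Fin n
  a ⋆ b with a ≟ᶠ b
  ... | yes _ = a
  ... | no _ with any? (λ c → (¬? (c ≟ᶠ a) ×-dec ¬? (c ≟ᶠ b)) ×-dec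
                              (isBlock (triple a b c) BoolP.≟ true))
  ...   | yes (c , _) = c
  ...   | no _ = a

  Distinct3 : Fin n → Fin n → Fin n → Set
  Distinct3 a b c = a ≢ b × b ≢ c × a ≢ c

  InA : Subset n → Set
  InA T = ∃ λ a → ∃ λ b → ∃ λ c → Distinct3 a b c × isBlock (triple a b c) ≡ false ×
          T ≡ (triple (a ⋆ b) (b ⋆ c) (c ⋆ a))

  InB : Subset n → Set
  InB T = ∃ λ a → ∃ λ b → ∃ λ c → Distinct3 a b c × T ≡ (triple (a ⋆ b) (b ⋆ c) (c ⋆ a))

  dist? : ∀ a b c → Dec (Distinct3 a b c)
  dist? a b c = ¬? (a ≟ᶠ b) ×-dec ¬? (b ≟ᶠ c) ×-dec ¬? (a ≟ᶠ c)

  InA? : ∀ T → Dec (InA T)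
  InA? T = any? λ a → any? λ b → any? λ c →
    dist? a b c ×-dec (isBlock (triple a b c) BoolP.≟ false) ×-dec
    ≡-dec BoolP._≟_ T (triple (a ⋆ b) (b ⋆ c) (c ⋆ a))

  InB? : ∀ T → Dec (InB T)
  InB? T = any? λ a → any? λ b → any? λ c →
    dist? a b c ×-dec ≡-dec BoolP._≟_ T (triple (a ⋆ b) (b ⋆ c) (c ⋆ a))

allSubsets : ∀ m → List (Subset m)
allSubsets zero    = [] ∷ []
allSubsets (suc m) = map (false ∷_) (allSubsets m) ++ map (true ∷_) (allSubsets m)

α : ∀ {n} → STS n → ℕ
α {n} S = length (filter (InA? S) (allSubsets n))

β : ∀ {n} → STS n → ℕ
β {n} S = length (filter (InB? S) (allSubsets n))

-- Projective geometry PG(k,2): points are the nonzero vectors of 𝔽₂^(k+1)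
-- (𝔽₂ = Bool with xor as addition); lines are the sets {x, y, x+y} with x ≠ y,
-- i.e. triples of distinct points x, y, z with z = x + y.
_⊕_ : ∀ {m} → Vec Bool m → Vec Bool m → Vec Bool m
_⊕_ = zipWith _xor_

PGPoint : (k : ℕ) → Vec Bool (suc k) → Set
PGPoint k v = v ≢ replicate (suc k) false

PGLine : (k : ℕ) → Vec Bool (suc k) → Vec Bool (suc k) → Vec Bool (suc k) → Set
PGLine k x y z = PGPoint k x × PGPoint k y × x ≢ y × z ≡ x ⊕ y

IsoPG : ∀ {n} → STS n → ℕ → Set
IsoPG {n} S k = Σ (Fin n → Vec Bool (suc k)) λ f →
  (∀ a b → f a ≡ f b → a ≡ b) ×
  (∀ a → PGPoint k (f a)) ×
  (∀ v → PGPoint k v → ∃ λ a → f a ≡ v) ×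
  (∀ a b c → a ≢ b → b ≢ c → a ≢ c →
     (STS.isBlock S (triple a b c) ≡ true → PGLine k (f a) (f b) (f c)) ×
     (PGLine k (f a) (f b) (f c) → STS.isBlock S (triple a b c) ≡ true))

module Submission where

-- For distinct a, b, c the derived set {a ⋆ b, b ⋆ c, c ⋆ a} always has three points. B(S) contains every
-- block, and when n > 3 A(S) contains, for any x ≠ y and any b off the line through them, the derived set of
-- the triangle b ⋆ x, b, b ⋆ y, which passes through x and y. So every pair is covered, and as each 3-set
-- contains three pairs, 3β ≥ C(n,2) with equality exactly when no pair lies in two members of B(S); likewise
-- for α. Either condition is equivalent to the Fano property: every triangle a, b, c spans a Fano plane, whose
-- seventh line is {a ⋆ b, b ⋆ c, c ⋆ a}. In a Fano system the points together with a new zero form an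
-- elementary abelian 2-group under x + y = x ⋆ y (x ≠ y), x + x = 0, the Fano property giving associativity;
-- extending a basis greedily identifies this group with 𝔽₂^(k+1), and then blocks with the lines of PG(k,2).
-- Conversely, in PG(k,2) the derived set {a + b, b + c, c + a} is a line.

open import Defs
open import Data.Bool using (Bool; true; false; if_then_else_; _xor_)
open import Data.Bool.Properties using (¬-not; xor-assoc; xor-comm; xor-identityˡ; xor-same) renaming (_≟_ to _≟ᵇ_)
open import Data.Empty using (⊥-elim)
open import Data.Fin using (Fin; zero; suc; _↑ˡ_; _↑ʳ_; splitAt)
open import Data.Fin.Properties
  using (any?; injective⇒≤; ↑ˡ-injective; ↑ʳ-injective; splitAt-↑ˡ; splitAt-↑ʳ)
  renaming (_≟_ to _≟ᶠ_; suc-injective to suc-injectiveᶠ)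
open import Data.Fin.Subset using (Subset; outside; inside; ⁅_⁆; _∪_; ∣_∣; _∈_; _∉_; _⊆_; ⊤; ⊥)
open import Data.Fin.Subset.Properties
  using (x∈⁅x⁆; x∈⁅y⁆⇒x≡y; x∉⁅y⁆⇒x≢y; x∈p∪q⁻; x∈p∪q⁺; ∣⁅x⁆∣≡1; ∣⊤∣≡n; ∣⊥∣≡0; ⊆⊤; ⊆-antisym;
         drop-there; drop-∷-⊆; out⊆; s⊆s; p⊆q⇒∣p∣≤∣q∣; ∣p∣≤∣x∷p∣; _⊆?_; anySubset?)
open import Data.List using (List; []; _∷_; _++_; map; filter; length)
open import Data.Nat.ListAction using (sum)
open import Data.List.Properties using (filter-++; length-++; map-cong)
open import Data.List.Membership.Propositional using () renaming (_∈_ to _∈ₗ_)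
open import Data.List.Membership.Propositional.Properties using (∈-++⁺ˡ; ∈-++⁺ʳ; ∈-map⁺; ∈-filter⁺; ∈-filter⁻)
import Data.List.Relation.Unary.Any as Any
open import Data.Maybe using (Maybe; nothing; just)
open import Data.Maybe.Properties using (just-injective) renaming (≡-dec to ≡-decᵐ)
open import Data.Nat using (ℕ; zero; suc; _+_; _*_; _^_; _≤_; _<_; _>_; _≥_; z≤n; s≤s; _≟_)
open import Data.Nat.Combinatorics using (_C_; nCk+nC[k+1]≡[n+1]C[k+1])
open import Data.Nat.Properties
  using (+-suc; +-comm; +-identityʳ; *-identityˡ; *-zeroʳ; *-suc; +-mono-≤; +-cancelʳ-≤; ≤-refl; ≤-reflexive;
         ≤-trans; ≤-antisym; <⇒≱; suc-injective; 0≢1+n; ^-monoʳ-≤; ≤-pred; _≤?_; ≰⇒>; +-commutativeSemigroup)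
open import Data.Product using (Σ; ∃; ∃₂; _×_; _,_; proj₁; proj₂)
open import Data.Sum using (_⊎_; inj₁; inj₂)
open import Data.Vec using (Vec; []; _∷_; replicate; here; there)
open import Data.Vec.Properties using (zipWith-assoc; zipWith-comm; zipWith-identityˡ; ≡-dec; ∷-injectiveʳ)
open import Function using (_∘_)
open import Function.Bundles using (_⇔_; mk⇔)
import Function.Properties.Equivalence as ⇔
open import Function.Definitions using (Injective)
open import Relation.Binary.PropositionalEquality
open import Relation.Nullary using (¬_; Dec; yes; no; does)
open import Relation.Nullary.Decidable using (_×-dec_; ¬?; dec-true; dec-false; decidable-stable)
open import Relation.Unary using (Decidable)
open import Algebra.Properties.CommutativeSemigroup +-commutativeSemigroup using (x∙yz≈y∙xz)

∣p∪q∣≡∣p∣+∣q∣ : ∀ {n} (p q : Subset n) → (∀ {x} → x ∈ p → x ∉ q) → ∣ p ∪ q ∣ ≡ ∣ p ∣ + ∣ q ∣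
∣p∪q∣≡∣p∣+∣q∣ [] [] _ = refl
∣p∪q∣≡∣p∣+∣q∣ (outside ∷ p) (outside ∷ q) disj = ∣p∪q∣≡∣p∣+∣q∣ p q (λ x∈p x∈q → disj (there x∈p) (there x∈q))
∣p∪q∣≡∣p∣+∣q∣ (outside ∷ p) (inside ∷ q) disj =
  trans (cong suc (∣p∪q∣≡∣p∣+∣q∣ p q (λ x∈p x∈q → disj (there x∈p) (there x∈q)))) (sym (+-suc _ _))
∣p∪q∣≡∣p∣+∣q∣ (inside ∷ p) (outside ∷ q) disj = cong suc (∣p∪q∣≡∣p∣+∣q∣ p q (λ x∈p x∈q → disj (there x∈p) (there x∈q)))
∣p∪q∣≡∣p∣+∣q∣ (inside ∷ p) (inside ∷ q) disj = ⊥-elim (disj here here)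

p⊆q∧∣q∣≤∣p∣⇒p≡q : ∀ {n} {p q : Subset n} → p ⊆ q → ∣ q ∣ ≤ ∣ p ∣ → p ≡ q
p⊆q∧∣q∣≤∣p∣⇒p≡q {p = []}          {[]}          _   _       = refl
p⊆q∧∣q∣≤∣p∣⇒p≡q {p = outside ∷ p} {outside ∷ q} p⊆q q≤p     = cong (outside ∷_) (p⊆q∧∣q∣≤∣p∣⇒p≡q (drop-∷-⊆ p⊆q) q≤p)
p⊆q∧∣q∣≤∣p∣⇒p≡q {p = inside ∷ p}  {inside ∷ q}  p⊆q (s≤s q≤p) = cong (inside ∷_) (p⊆q∧∣q∣≤∣p∣⇒p≡q (drop-∷-⊆ p⊆q) q≤p)
p⊆q∧∣q∣≤∣p∣⇒p≡q {p = inside ∷ p}  {outside ∷ q} p⊆q _       with () ← p⊆q here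
p⊆q∧∣q∣≤∣p∣⇒p≡q {p = outside ∷ p} {inside ∷ q}  p⊆q q≤p     = ⊥-elim (<⇒≱ (s≤s (p⊆q⇒∣p∣≤∣q∣ (drop-∷-⊆ p⊆q))) q≤p)

∣q∣<∣p∣⇒∃∈p∉q : ∀ {n} {p q : Subset n} → ∣ q ∣ < ∣ p ∣ → ∃ λ x → x ∈ p × x ∉ q
∣q∣<∣p∣⇒∃∈p∉q {p = inside ∷ p}  {outside ∷ q} _ = zero , here , λ ()
∣q∣<∣p∣⇒∃∈p∉q {p = inside ∷ p}  {inside ∷ q} (s≤s q<p) with x , x∈p , x∉q ← ∣q∣<∣p∣⇒∃∈p∉q q<p =
  suc x , there x∈p , x∉q ∘ drop-there
∣q∣<∣p∣⇒∃∈p∉q {p = outside ∷ p} {s ∷ q} q<p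
  with x , x∈p , x∉q ← ∣q∣<∣p∣⇒∃∈p∉q {p = p} {q} (≤-trans (s≤s (∣p∣≤∣x∷p∣ s q)) q<p) =
  suc x , there x∈p , x∉q ∘ drop-there

pair : ∀ {n} → Fin n → Fin n → Subset n
pair a b = ⁅ a ⁆ ∪ ⁅ b ⁆

module _ {n : ℕ} {a b : Fin n} where

  ∈-pair⁻ : ∀ {x} → x ∈ pair a b → x ≡ a ⊎ x ≡ b
  ∈-pair⁻ x∈ with x∈p∪q⁻ ⁅ a ⁆ ⁅ b ⁆ x∈
  ... | inj₁ x∈a = inj₁ (x∈⁅y⁆⇒x≡y a x∈a)
  ... | inj₂ x∈b = inj₂ (x∈⁅y⁆⇒x≡y b x∈b)

  a∈pair : a ∈ pair a b
  a∈pair = x∈p∪q⁺ (inj₁ (x∈⁅x⁆ a))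

  b∈pair : b ∈ pair a b
  b∈pair = x∈p∪q⁺ (inj₂ (x∈⁅x⁆ b))

  pair-⊆ : ∀ {T} → a ∈ T → b ∈ T → pair a b ⊆ T
  pair-⊆ a∈T b∈T x∈ with ∈-pair⁻ x∈
  ... | inj₁ refl = a∈T
  ... | inj₂ refl = b∈T

  ∣pair∣≡2 : a ≢ b → ∣ pair a b ∣ ≡ 2
  ∣pair∣≡2 a≢b = trans (∣p∪q∣≡∣p∣+∣q∣ ⁅ a ⁆ ⁅ b ⁆ disjoint) (cong₂ _+_ (∣⁅x⁆∣≡1 a) (∣⁅x⁆∣≡1 b))
    where
    disjoint : ∀ {x} → x ∈ ⁅ a ⁆ → x ∉ ⁅ b ⁆
    disjoint x∈a x∈b = a≢b (trans (sym (x∈⁅y⁆⇒x≡y a x∈a)) (x∈⁅y⁆⇒x≡y b x∈b))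

∣p∣≡2⇒≡pair : ∀ {n} {p : Subset n} → ∣ p ∣ ≡ 2 → ∃₂ λ x y → x ≢ y × p ≡ pair x y
∣p∣≡2⇒≡pair {n} {p} ∣p∣≡2
  with x , x∈p , _   ← ∣q∣<∣p∣⇒∃∈p∉q {p = p} {⊥} (subst₂ _<_ (sym (∣⊥∣≡0 n)) (sym ∣p∣≡2) (s≤s z≤n))
  with y , y∈p , y∉x ← ∣q∣<∣p∣⇒∃∈p∉q {p = p} {⁅ x ⁆} (subst₂ _<_ (sym (∣⁅x⁆∣≡1 x)) (sym ∣p∣≡2) ≤-refl) =
  x , y , x≢y , sym (p⊆q∧∣q∣≤∣p∣⇒p≡q (pair-⊆ x∈p y∈p) (≤-reflexive (trans ∣p∣≡2 (sym (∣pair∣≡2 x≢y)))))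
  where
  x≢y : x ≢ y
  x≢y = ≢-sym (x∉⁅y⁆⇒x≢y y∉x)

module _ {n : ℕ} {a b c : Fin n} where

  ∈-triple⁻ : ∀ {x} → x ∈ triple a b c → x ≡ a ⊎ x ≡ b ⊎ x ≡ c
  ∈-triple⁻ x∈ with x∈p∪q⁻ ⁅ a ⁆ (pair b c) x∈
  ... | inj₁ x∈a = inj₁ (x∈⁅y⁆⇒x≡y a x∈a)
  ... | inj₂ x∈bc = inj₂ (∈-pair⁻ {a = b} {c} x∈bc)

  a∈triple : a ∈ triple a b c
  a∈triple = x∈p∪q⁺ (inj₁ (x∈⁅x⁆ a))

  b∈triple : b ∈ triple a b c
  b∈triple = x∈p∪q⁺ (inj₂ (a∈pair {a = b} {c}))

  c∈triple : c ∈ triple a b c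
  c∈triple = x∈p∪q⁺ (inj₂ (b∈pair {a = b} {c}))

  triple-⊆ : ∀ {T} → a ∈ T → b ∈ T → c ∈ T → triple a b c ⊆ T
  triple-⊆ a∈T b∈T c∈T x∈ with ∈-triple⁻ x∈
  ... | inj₁ refl = a∈T
  ... | inj₂ (inj₁ refl) = b∈T
  ... | inj₂ (inj₂ refl) = c∈T

  ∣triple∣≡3 : a ≢ b × b ≢ c × a ≢ c → ∣ triple a b c ∣ ≡ 3
  ∣triple∣≡3 (a≢b , b≢c , a≢c) =
    trans (∣p∪q∣≡∣p∣+∣q∣ ⁅ a ⁆ (pair b c) disjoint) (cong₂ _+_ (∣⁅x⁆∣≡1 a) (∣pair∣≡2 {a = b} {c} b≢c))
    where
    disjoint : ∀ {x} → x ∈ ⁅ a ⁆ → x ∉ pair b c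
    disjoint x∈a x∈bc with x∈⁅y⁆⇒x≡y a x∈a | ∈-pair⁻ {a = b} {c} x∈bc
    ... | refl | inj₁ x≡b = a≢b x≡b
    ... | refl | inj₂ x≡c = a≢c x≡c

  triple≡ : ∀ {T} → a ≢ b × b ≢ c × a ≢ c → a ∈ T → b ∈ T → c ∈ T → ∣ T ∣ ≡ 3 → triple a b c ≡ T
  triple≡ abc a∈T b∈T c∈T ∣T∣≡3 =
    p⊆q∧∣q∣≤∣p∣⇒p≡q (triple-⊆ a∈T b∈T c∈T) (≤-reflexive (trans ∣T∣≡3 (sym (∣triple∣≡3 abc))))

triple-rotate : ∀ {n} {a b c : Fin n} → triple b c a ≡ triple a b c
triple-rotate {a = a} {b} {c} =
  ⊆-antisym (triple-⊆ b∈triple c∈triple a∈triple)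
            (triple-⊆ (c∈triple {a = b} {c} {a}) (a∈triple {a = b} {c} {a}) (b∈triple {a = b} {c} {a}))

count : {A : Set} {P : A → Set} → Decidable P → List A → ℕ
count P? xs = length (filter P? xs)

module _ {A : Set} where

  1≤length : ∀ {x : A} {ys} → x ∈ₗ ys → 1 ≤ length ys
  1≤length {ys = _ ∷ _} _ = s≤s z≤n

  length≡1⇒∈-unique : ∀ {x y : A} {zs} → length zs ≡ 1 → x ∈ₗ zs → y ∈ₗ zs → x ≡ y
  length≡1⇒∈-unique {zs = _ ∷ []} _ (Any.here refl) (Any.here refl) = refl

module _ {A : Set} {P : A → Set} (P? : Decidable P) where

  count-++ : ∀ xs ys → count P? (xs ++ ys) ≡ count P? xs + count P? ys
  count-++ xs ys = trans (cong length (filter-++ P? xs ys)) (length-++ (filter P? xs))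

  count-map : ∀ {B : Set} (f : B → A) xs → count P? (map f xs) ≡ count (P? ∘ f) xs
  count-map f [] = refl
  count-map f (x ∷ xs) with P? (f x)
  ... | yes _ = cong suc (count-map f xs)
  ... | no _  = count-map f xs

  count-cong : ∀ {Q : A → Set} (Q? : Decidable Q) → (∀ {x} → P x → Q x) → (∀ {x} → Q x → P x) →
               ∀ xs → count P? xs ≡ count Q? xs
  count-cong Q? P⇒Q Q⇒P [] = refl
  count-cong Q? P⇒Q Q⇒P (x ∷ xs) with P? x | Q? x
  ... | yes _  | yes _  = cong suc (count-cong Q? P⇒Q Q⇒P xs)
  ... | no _   | no _   = count-cong Q? P⇒Q Q⇒P xs
  ... | yes px | no ¬qx = ⊥-elim (¬qx (P⇒Q px))
  ... | no ¬px | yes qx = ⊥-elim (¬px (Q⇒P qx))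

  count-filter : ∀ {Q : A → Set} (Q? : Decidable Q) xs → count Q? (filter P? xs) ≡ count (λ x → P? x ×-dec Q? x) xs
  count-filter Q? [] = refl
  count-filter Q? (x ∷ xs) with P? x
  ... | no _ = count-filter Q? xs
  ... | yes _ with Q? x
  ...   | yes _ = cong suc (count-filter Q? xs)
  ...   | no _  = count-filter Q? xs

  count≡0 : ∀ xs → (∀ x → ¬ P x) → count P? xs ≡ 0
  count≡0 [] _ = refl
  count≡0 (x ∷ xs) ¬P with P? x
  ... | yes px = ⊥-elim (¬P x px)
  ... | no _   = count≡0 xs ¬P

  count≥1 : ∀ {x xs} → x ∈ₗ xs → P x → 1 ≤ count P? xs
  count≥1 x∈xs px = 1≤length (∈-filter⁺ P? x∈xs px)

  count≡1⇒unique : ∀ {x y xs} → count P? xs ≡ 1 → x ∈ₗ xs → y ∈ₗ xs → P x → P y → x ≡ y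
  count≡1⇒unique c≡1 x∈xs y∈xs px py = length≡1⇒∈-unique c≡1 (∈-filter⁺ P? x∈xs px) (∈-filter⁺ P? y∈xs py)

module _ {A : Set} (f : A → ℕ) where

  sum-map-const : ∀ {k} xs → (∀ {x} → x ∈ₗ xs → f x ≡ k) → sum (map f xs) ≡ k * length xs
  sum-map-const {k} [] _ = sym (*-zeroʳ k)
  sum-map-const {k} (x ∷ xs) f≡k =
    trans (cong₂ _+_ (f≡k (Any.here refl)) (sum-map-const xs (f≡k ∘ Any.there))) (sym (*-suc k (length xs)))

  length≤sum-map : ∀ xs → (∀ {x} → x ∈ₗ xs → 1 ≤ f x) → length xs ≤ sum (map f xs)
  length≤sum-map [] _ = z≤n
  length≤sum-map (x ∷ xs) 1≤f = +-mono-≤ (1≤f (Any.here refl)) (length≤sum-map xs (1≤f ∘ Any.there))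

  sum-map≡length⇒≡1 : ∀ xs → (∀ {x} → x ∈ₗ xs → 1 ≤ f x) → sum (map f xs) ≡ length xs → ∀ {x} → x ∈ₗ xs → f x ≡ 1
  sum-map≡length⇒≡1 (y ∷ ys) 1≤f sum≡ x∈ = case x∈
    where
    fy≡1 : f y ≡ 1
    fy≡1 = ≤-antisym
      (+-cancelʳ-≤ (sum (map f ys)) (f y) 1 (≤-trans (≤-reflexive sum≡) (s≤s (length≤sum-map ys (1≤f ∘ Any.there)))))
      (1≤f (Any.here refl))
    case : ∀ {x} → x ∈ₗ y ∷ ys → f x ≡ 1
    case (Any.here refl) = fy≡1
    case (Any.there x∈ys) =
      sum-map≡length⇒≡1 ys (1≤f ∘ Any.there) (suc-injective (trans (cong (_+ sum (map f ys)) (sym fy≡1)) sum≡)) x∈ys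

module _ {A B : Set} {R : A → B → Set} (R? : ∀ x y → Dec (R x y)) where

  private
    column : B → List A → ℕ
    column y xs = count (λ x → R? x y) xs

    sum-column-∷ : ∀ x xs ys →
                   sum (map (λ y → column y (x ∷ xs)) ys) ≡ count (R? x) ys + sum (map (λ y → column y xs) ys)
    sum-column-∷ x xs [] = refl
    sum-column-∷ x xs (y ∷ ys) with R? x y
    ... | yes _ = cong suc (trans (cong (column y xs +_) (sum-column-∷ x xs ys))
                                  (x∙yz≈y∙xz (column y xs) (count (R? x) ys) _))
    ... | no _  = trans (cong (column y xs +_) (sum-column-∷ x xs ys)) (x∙yz≈y∙xz (column y xs) (count (R? x) ys) _)

  double-count : ∀ xs ys → sum (map (λ x → count (R? x) ys) xs) ≡ sum (map (λ y → column y xs) ys)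
  double-count [] ys = sym (sum-map-const (λ y → column y []) ys (λ _ → refl))
  double-count (x ∷ xs) ys = trans (cong (count (R? x) ys +_) (double-count xs ys)) (sym (sum-column-∷ x xs ys))

-- Counting subsets of Fin n

_≟ˢ_ : ∀ {n} → (p q : Subset n) → Dec (p ≡ q)
_≟ˢ_ = ≡-dec _≟ᵇ_

∈-allSubsets : ∀ {n} (T : Subset n) → T ∈ₗ allSubsets n
∈-allSubsets [] = Any.here refl
∈-allSubsets {suc n} (outside ∷ T) = ∈-++⁺ˡ (∈-map⁺ (outside ∷_) (∈-allSubsets T))
∈-allSubsets {suc n} (inside ∷ T) = ∈-++⁺ʳ (map (outside ∷_) (allSubsets n)) (∈-map⁺ (inside ∷_) (∈-allSubsets T))

count-allSubsets-∷ : ∀ {n} {P : Subset (suc n) → Set} (P? : Decidable P) →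
  count P? (allSubsets (suc n)) ≡ count (P? ∘ (outside ∷_)) (allSubsets n) + count (P? ∘ (inside ∷_)) (allSubsets n)
count-allSubsets-∷ {n} P? = trans (count-++ P? (map (outside ∷_) (allSubsets n)) _)
  (cong₂ _+_ (count-map P? (outside ∷_) (allSubsets n)) (count-map P? (inside ∷_) (allSubsets n)))

count-allSubsets-≡ : ∀ {n} (T : Subset n) → count (_≟ˢ T) (allSubsets n) ≡ 1
count-allSubsets-≡ [] = refl
count-allSubsets-≡ {suc n} (outside ∷ T) = begin
  count (_≟ˢ (outside ∷ T)) (allSubsets (suc n))
    ≡⟨ count-allSubsets-∷ (_≟ˢ (outside ∷ T)) ⟩
  count (λ U → (outside ∷ U) ≟ˢ (outside ∷ T)) (allSubsets n)
    + count (λ U → (inside ∷ U) ≟ˢ (outside ∷ T)) (allSubsets n)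
    ≡⟨ cong₂ _+_ (count-cong _ (_≟ˢ T) ∷-injectiveʳ (cong (outside ∷_)) (allSubsets n))
                 (count≡0 _ (allSubsets n) (λ _ ())) ⟩
  count (_≟ˢ T) (allSubsets n) + 0
    ≡⟨ cong (_+ 0) (count-allSubsets-≡ T) ⟩
  1 ∎
  where open ≡-Reasoning
count-allSubsets-≡ {suc n} (inside ∷ T) = begin
  count (_≟ˢ (inside ∷ T)) (allSubsets (suc n))
    ≡⟨ count-allSubsets-∷ (_≟ˢ (inside ∷ T)) ⟩
  count (λ U → (outside ∷ U) ≟ˢ (inside ∷ T)) (allSubsets n)
    + count (λ U → (inside ∷ U) ≟ˢ (inside ∷ T)) (allSubsets n)
    ≡⟨ cong₂ _+_ (count≡0 _ (allSubsets n) (λ _ ()))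
                 (count-cong _ (_≟ˢ T) ∷-injectiveʳ (cong (inside ∷_)) (allSubsets n)) ⟩
  0 + count (_≟ˢ T) (allSubsets n)
    ≡⟨ count-allSubsets-≡ T ⟩
  1 ∎
  where open ≡-Reasoning

count-allSubsets≡1 : ∀ {n} {P : Subset n → Set} (P? : Decidable P) {T} → P T → (∀ {U} → P U → U ≡ T) →
                     count P? (allSubsets n) ≡ 1
count-allSubsets≡1 {n} P? {T} pT unique =
  trans (count-cong P? (_≟ˢ T) unique (λ { refl → pT }) (allSubsets n)) (count-allSubsets-≡ T)

SizedSubsetOf : ∀ {n} → Subset n → ℕ → Subset n → Set
SizedSubsetOf T k U = ∣ U ∣ ≡ k × U ⊆ T

sizedSubsetOf? : ∀ {n} (T : Subset n) k → Decidable (SizedSubsetOf T k)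
sizedSubsetOf? T k U = (∣ U ∣ ≟ k) ×-dec (U ⊆? T)

count-sizedSubsetOf : ∀ {n} (T : Subset n) k → count (sizedSubsetOf? T k) (allSubsets n) ≡ ∣ T ∣ C k
count-sizedSubsetOf [] zero = refl
count-sizedSubsetOf [] (suc k) = refl
count-sizedSubsetOf {suc n} (t ∷ T) k = begin
  count (sizedSubsetOf? (t ∷ T) k) (allSubsets (suc n))
    ≡⟨ count-allSubsets-∷ (sizedSubsetOf? (t ∷ T) k) ⟩
  count (sizedSubsetOf? (t ∷ T) k ∘ (outside ∷_)) (allSubsets n)
    + count (sizedSubsetOf? (t ∷ T) k ∘ (inside ∷_)) (allSubsets n)
    ≡⟨ cong (_+ count (sizedSubsetOf? (t ∷ T) k ∘ (inside ∷_)) (allSubsets n)) excluding ⟩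
  ∣ T ∣ C k + count (sizedSubsetOf? (t ∷ T) k ∘ (inside ∷_)) (allSubsets n)
    ≡⟨ including t k ⟩
  ∣ t ∷ T ∣ C k ∎
  where
  open ≡-Reasoning
  excluding : count (sizedSubsetOf? (t ∷ T) k ∘ (outside ∷_)) (allSubsets n) ≡ ∣ T ∣ C k
  excluding = trans
    (count-cong (sizedSubsetOf? (t ∷ T) k ∘ (outside ∷_)) (sizedSubsetOf? T k)
                (λ (∣U∣ , U⊆) → ∣U∣ , drop-∷-⊆ U⊆) (λ (∣U∣ , U⊆) → ∣U∣ , out⊆ U⊆) (allSubsets n))
    (count-sizedSubsetOf T k)

  including : ∀ t k → ∣ T ∣ C k + count (sizedSubsetOf? (t ∷ T) k ∘ (inside ∷_)) (allSubsets n) ≡ ∣ t ∷ T ∣ C k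
  including outside k = trans
    (cong (∣ T ∣ C k +_) (count≡0 (sizedSubsetOf? (outside ∷ T) k ∘ (inside ∷_)) (allSubsets n)
                                  λ _ (_ , U⊆) → outside∌zero (U⊆ here)))
    (+-identityʳ _)
    where
    outside∌zero : zero ∉ outside ∷ T
    outside∌zero ()
  including inside zero = trans
    (cong (∣ T ∣ C 0 +_) (count≡0 (sizedSubsetOf? (inside ∷ T) 0 ∘ (inside ∷_)) (allSubsets n)
                                  λ _ (∣U∣≡0 , _) → 0≢1+n (sym ∣U∣≡0)))
    (+-identityʳ _)
  including inside (suc k) = begin
    ∣ T ∣ C suc k + count (sizedSubsetOf? (inside ∷ T) (suc k) ∘ (inside ∷_)) (allSubsets n)
      ≡⟨ cong (∣ T ∣ C suc k +_)
              (count-cong (sizedSubsetOf? (inside ∷ T) (suc k) ∘ (inside ∷_)) (sizedSubsetOf? T k)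
                          (λ (∣U∣ , U⊆) → suc-injective ∣U∣ , drop-∷-⊆ U⊆) (λ (∣U∣ , U⊆) → cong suc ∣U∣ , s⊆s U⊆)
                          (allSubsets n)) ⟩
    ∣ T ∣ C suc k + count (sizedSubsetOf? T k) (allSubsets n)
      ≡⟨ cong (∣ T ∣ C suc k +_) (count-sizedSubsetOf T k) ⟩
    ∣ T ∣ C suc k + ∣ T ∣ C k
      ≡⟨ +-comm (∣ T ∣ C suc k) (∣ T ∣ C k) ⟩
    ∣ T ∣ C k + ∣ T ∣ C suc k
      ≡⟨ nCk+nC[k+1]≡[n+1]C[k+1] ∣ T ∣ k ⟩
    suc ∣ T ∣ C suc k ∎

count-pairs : ∀ n → count (λ U → ∣ U ∣ ≟ 2) (allSubsets n) ≡ n C 2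
count-pairs n = begin
  count (λ U → ∣ U ∣ ≟ 2) (allSubsets n)          ≡⟨ count-cong _ (sizedSubsetOf? ⊤ 2) (_, ⊆⊤) proj₁ (allSubsets n) ⟩
  count (sizedSubsetOf? (⊤ {n}) 2) (allSubsets n) ≡⟨ count-sizedSubsetOf (⊤ {n}) 2 ⟩
  ∣ ⊤ {n} ∣ C 2                                   ≡⟨ cong (_C 2) (∣⊤∣≡n n) ⟩
  n C 2 ∎
  where open ≡-Reasoning

-- Families of 3-subsets and the pairs they cover

CoversPairs : ∀ {n} → (Subset n → Set) → Set
CoversPairs F = ∀ {x y} → x ≢ y → ∃ λ T → F T × x ∈ T × y ∈ T

PairsUnique : ∀ {n} → (Subset n → Set) → Set
PairsUnique F = ∀ {x y T T′} → x ≢ y → F T → F T′ → x ∈ T → y ∈ T → x ∈ T′ → y ∈ T′ → T ≡ T′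

module _ {n : ℕ} {F : Subset n → Set} (F? : Decidable F) (∣F∣≡3 : ∀ {T} → F T → ∣ T ∣ ≡ 3) where

  private
    members pairs : List (Subset n)
    members = filter F? (allSubsets n)
    pairs = filter (λ U → ∣ U ∣ ≟ 2) (allSubsets n)

    degree : Subset n → ℕ
    degree U = count (λ T → F? T ×-dec (U ⊆? T)) (allSubsets n)

    3*count≡sum-degree : 3 * count F? (allSubsets n) ≡ sum (map degree pairs)
    3*count≡sum-degree = begin
      3 * count F? (allSubsets n)
        ≡⟨ sym (sum-map-const (λ T → count (_⊆? T) pairs) members three-pairs) ⟩
      sum (map (λ T → count (_⊆? T) pairs) members)
        ≡⟨ double-count (λ T U → U ⊆? T) members pairs ⟩
      sum (map (λ U → count (U ⊆?_) members) pairs)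
        ≡⟨ cong sum (map-cong (λ U → count-filter F? (U ⊆?_) (allSubsets n)) pairs) ⟩
      sum (map degree pairs) ∎
      where
      open ≡-Reasoning
      three-pairs : ∀ {T} → T ∈ₗ members → count (_⊆? T) pairs ≡ 3
      three-pairs {T} T∈ = begin
        count (_⊆? T) pairs
          ≡⟨ count-filter (λ U → ∣ U ∣ ≟ 2) (_⊆? T) (allSubsets n) ⟩
        count (sizedSubsetOf? T 2) (allSubsets n)
          ≡⟨ count-sizedSubsetOf T 2 ⟩
        ∣ T ∣ C 2
          ≡⟨ cong (_C 2) (∣F∣≡3 (proj₂ (∈-filter⁻ F? {xs = allSubsets n} T∈))) ⟩
        3 ∎

    ∈pairs⇒≡pair : ∀ {U} → U ∈ₗ pairs → ∃₂ λ x y → x ≢ y × U ≡ pair x y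
    ∈pairs⇒≡pair U∈ = ∣p∣≡2⇒≡pair (proj₂ (∈-filter⁻ (λ U → ∣ U ∣ ≟ 2) {xs = allSubsets n} U∈))

    pair∈pairs : ∀ {x y} → x ≢ y → pair x y ∈ₗ pairs
    pair∈pairs {x} {y} x≢y = ∈-filter⁺ (λ U → ∣ U ∣ ≟ 2) (∈-allSubsets (pair x y)) (∣pair∣≡2 x≢y)

  3*count≡nC2⇔PairsUnique : CoversPairs F → (3 * count F? (allSubsets n) ≡ n C 2) ⇔ PairsUnique F
  3*count≡nC2⇔PairsUnique covers = mk⇔ 3*count≡nC2⇒unique unique⇒3*count≡nC2
    where
    degree≥1 : ∀ {U} → U ∈ₗ pairs → 1 ≤ degree U
    degree≥1 U∈ with x , y , x≢y , refl ← ∈pairs⇒≡pair U∈ with T , FT , x∈T , y∈T ← covers x≢y =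
      count≥1 (λ T → F? T ×-dec (pair x y ⊆? T)) (∈-allSubsets T) (FT , pair-⊆ x∈T y∈T)

    3*count≡nC2⇒unique : 3 * count F? (allSubsets n) ≡ n C 2 → PairsUnique F
    3*count≡nC2⇒unique 3*count≡nC2 {x} {y} {T} {T′} x≢y FT FT′ x∈T y∈T x∈T′ y∈T′ =
      count≡1⇒unique (λ T → F? T ×-dec (pair x y ⊆? T)) degree≡1 (∈-allSubsets T) (∈-allSubsets T′)
                     (FT , pair-⊆ x∈T y∈T) (FT′ , pair-⊆ x∈T′ y∈T′)
      where
      degree≡1 : degree (pair x y) ≡ 1
      degree≡1 = sum-map≡length⇒≡1 degree pairs degree≥1
                   (trans (sym 3*count≡sum-degree) (trans 3*count≡nC2 (sym (count-pairs n)))) (pair∈pairs x≢y)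

    unique⇒3*count≡nC2 : PairsUnique F → 3 * count F? (allSubsets n) ≡ n C 2
    unique⇒3*count≡nC2 unique = begin
      3 * count F? (allSubsets n) ≡⟨ 3*count≡sum-degree ⟩
      sum (map degree pairs)      ≡⟨ sum-map-const degree pairs degree≡1 ⟩
      1 * length pairs            ≡⟨ *-identityˡ (length pairs) ⟩
      length pairs                ≡⟨ count-pairs n ⟩
      n C 2 ∎
      where
      open ≡-Reasoning
      degree≡1 : ∀ {U} → U ∈ₗ pairs → degree U ≡ 1
      degree≡1 U∈ with x , y , x≢y , refl ← ∈pairs⇒≡pair U∈ with T , FT , x∈T , y∈T ← covers x≢y =
        count-allSubsets≡1 (λ T → F? T ×-dec (pair x y ⊆? T)) (FT , pair-⊆ x∈T y∈T)
          (λ (FT′ , xy⊆T′) → unique x≢y FT′ FT (xy⊆T′ a∈pair) (xy⊆T′ b∈pair) x∈T y∈T)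

⊕-assoc : ∀ {m} (u v w : Vec Bool m) → (u ⊕ v) ⊕ w ≡ u ⊕ (v ⊕ w)
⊕-assoc = zipWith-assoc xor-assoc

⊕-comm : ∀ {m} (v w : Vec Bool m) → v ⊕ w ≡ w ⊕ v
⊕-comm = zipWith-comm xor-comm

⊕-identityˡ : ∀ {m} (v : Vec Bool m) → replicate m false ⊕ v ≡ v
⊕-identityˡ = zipWith-identityˡ xor-identityˡ

⊕-self : ∀ {m} (v : Vec Bool m) → v ⊕ v ≡ replicate m false
⊕-self [] = refl
⊕-self (x ∷ v) = cong₂ _∷_ (xor-same x) (⊕-self v)

v⊕[v⊕w]≡w : ∀ {m} (v w : Vec Bool m) → v ⊕ (v ⊕ w) ≡ w
v⊕[v⊕w]≡w v w = trans (sym (⊕-assoc v v w)) (trans (cong (_⊕ w) (⊕-self v)) (⊕-identityˡ w))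

thermometer : ∀ {m} → Fin (suc m) → Vec Bool m
thermometer {m} zero = replicate m false
thermometer {suc m} (suc i) = true ∷ thermometer i

thermometer-injective : ∀ {m} → Injective _≡_ _≡_ (thermometer {m})
thermometer-injective {m}     {zero}  {zero}  _  = refl
thermometer-injective {suc m} {zero}  {suc j} ()
thermometer-injective {suc m} {suc i} {zero}  ()
thermometer-injective {suc m} {suc i} {suc j} eq = cong suc (thermometer-injective (∷-injectiveʳ eq))

binary : ∀ {m} → Vec Bool m → Fin (2 ^ m)
binary [] = zero
binary {suc m} (false ∷ v) = binary v ↑ˡ (2 ^ m + 0)
binary {suc m} (true ∷ v) = 2 ^ m ↑ʳ (binary v ↑ˡ 0)

binary-injective : ∀ {m} → Injective _≡_ _≡_ (binary {m})
binary-injective {zero} {[]} {[]} _ = refl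
binary-injective {suc m} {false ∷ v} {false ∷ w} eq = cong (false ∷_) (binary-injective (↑ˡ-injective _ _ _ eq))
binary-injective {suc m} {true ∷ v} {true ∷ w} eq =
  cong (true ∷_) (binary-injective (↑ˡ-injective 0 _ _ (↑ʳ-injective (2 ^ m) _ _ eq)))
binary-injective {suc m} {false ∷ v} {true ∷ w} eq
  with () ← trans (sym (splitAt-↑ˡ (2 ^ m) (binary v) _)) (trans (cong (splitAt (2 ^ m)) eq) (splitAt-↑ʳ (2 ^ m) _ _))
binary-injective {suc m} {true ∷ v} {false ∷ w} eq
  with () ← trans (sym (splitAt-↑ˡ (2 ^ m) (binary w) _))
                  (trans (cong (splitAt (2 ^ m)) (sym eq)) (splitAt-↑ʳ (2 ^ m) _ _))

toFinᵐ : ∀ {n} → Maybe (Fin n) → Fin (suc n)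
toFinᵐ nothing = zero
toFinᵐ (just a) = suc a

toFinᵐ-injective : ∀ {n} → Injective _≡_ _≡_ (toFinᵐ {n})
toFinᵐ-injective {x = nothing} {nothing} _ = refl
toFinᵐ-injective {x = just a} {just b} eq = cong just (suc-injectiveᶠ eq)

fromFinᵐ : ∀ {n} → Fin (suc n) → Maybe (Fin n)
fromFinᵐ zero = nothing
fromFinᵐ (suc a) = just a

fromFinᵐ-injective : ∀ {n} → Injective _≡_ _≡_ (fromFinᵐ {n})
fromFinᵐ-injective {x = zero} {zero} _ = refl
fromFinᵐ-injective {x = suc a} {suc b} eq = cong suc (just-injective eq)

-- The Steiner quasigroup

module Steiner {n : ℕ} (S : STS n) where
  open STS S

  Block : Subset n → Set
  Block T = isBlock T ≡ true

  Distinct : Fin n → Fin n → Fin n → Set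
  Distinct = Distinct3 S

  infixl 7 _∙_
  _∙_ : Fin n → Fin n → Fin n
  _∙_ = _⋆_ S

  blocks-pairsUnique : PairsUnique Block
  blocks-pairsUnique {x} {y} {T} {T′} x≢y blockT blockT′ x∈T y∈T x∈T′ y∈T′
    with _ , _ , _ , _ , unique ← pairUnique x y x≢y =
    trans (unique T blockT x∈T y∈T) (sym (unique T′ blockT′ x∈T′ y∈T′))

  third-point : ∀ {a b} → a ≢ b → ∃ λ c → (c ≢ a × c ≢ b) × Block (triple a b c)
  third-point {a} {b} a≢b
    with T , blockT , a∈T , b∈T , _ ← pairUnique a b a≢b
    with c , c∈T , c∉ab ← ∣q∣<∣p∣⇒∃∈p∉q {p = T} {pair a b}
                            (subst₂ _<_ (sym (∣pair∣≡2 a≢b)) (sym (blockSize T blockT)) ≤-refl) =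
    c , (c≢a , c≢b) , subst Block (sym (triple≡ (a≢b , ≢-sym c≢b , ≢-sym c≢a) a∈T b∈T c∈T (blockSize T blockT))) blockT
    where
    c≢a : c ≢ a
    c≢a refl = c∉ab a∈pair
    c≢b : c ≢ b
    c≢b refl = c∉ab b∈pair

  ∙-third : ∀ {a b} → a ≢ b → (a ∙ b ≢ a × a ∙ b ≢ b) × Block (triple a b (a ∙ b))
  ∙-third {a} {b} a≢b with a ≟ᶠ b
  ... | yes a≡b = ⊥-elim (a≢b a≡b)
  ... | no _ with any? (λ c → (¬? (c ≟ᶠ a) ×-dec ¬? (c ≟ᶠ b)) ×-dec (isBlock (triple a b c) ≟ᵇ true))
  ...   | yes (_ , third) = third
  ...   | no ¬third = ⊥-elim (¬third (third-point a≢b))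

  ∙-idem : ∀ a → a ∙ a ≡ a
  ∙-idem a with a ≟ᶠ a
  ... | yes _ = refl
  ... | no a≢a = ⊥-elim (a≢a refl)

  ∙-onBlock : ∀ {T a b c} → Block T → a ∈ T → b ∈ T → c ∈ T → a ≢ b × b ≢ c × a ≢ c → a ∙ b ≡ c
  ∙-onBlock {T} {a} {b} {c} blockT a∈T b∈T c∈T (a≢b , b≢c , a≢c)
    with ∈-triple⁻ (subst (c ∈_) (blocks-pairsUnique a≢b blockT (proj₂ (∙-third a≢b)) a∈T b∈T a∈triple b∈triple) c∈T)
  ... | inj₁ refl = ⊥-elim (a≢c refl)
  ... | inj₂ (inj₁ refl) = ⊥-elim (b≢c refl)
  ... | inj₂ (inj₂ c≡a∙b) = sym c≡a∙b

  block⇒∙ : ∀ {a b c} → Distinct a b c → Block (triple a b c) → a ∙ b ≡ c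
  block⇒∙ abc block = ∙-onBlock block a∈triple b∈triple c∈triple abc

  -- A case split on a ≟ b by with-abstraction would also rewrite the a ≟ b inside the definition of a ∙ b.
  ≟-cases : {P : Fin n → Fin n → Set} → (∀ a → P a a) → (∀ {a b} → a ≢ b → P a b) → ∀ a b → P a b
  ≟-cases {P} equal distinct a b = cases (a ≟ᶠ b)
    where
    cases : Dec (a ≡ b) → P a b
    cases (yes refl) = equal a
    cases (no a≢b) = distinct a≢b

  ∙-comm : ∀ a b → a ∙ b ≡ b ∙ a
  ∙-comm = ≟-cases (λ _ → refl) λ a≢b → let (a∙b≢a , a∙b≢b) , block = ∙-third a≢b in
    sym (∙-onBlock block b∈triple a∈triple c∈triple (≢-sym a≢b , ≢-sym a∙b≢a , ≢-sym a∙b≢b))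

  a∙[a∙b]≡b : ∀ a b → a ∙ (a ∙ b) ≡ b
  a∙[a∙b]≡b = ≟-cases (λ a → trans (cong (a ∙_) (∙-idem a)) (∙-idem a)) λ a≢b →
    let (a∙b≢a , a∙b≢b) , block = ∙-third a≢b in
    ∙-onBlock block a∈triple c∈triple b∈triple (≢-sym a∙b≢a , a∙b≢b , a≢b)

  [a∙b]∙b≡a : ∀ a b → (a ∙ b) ∙ b ≡ a
  [a∙b]∙b≡a a b = trans (∙-comm (a ∙ b) b) (trans (cong (b ∙_) (∙-comm a b)) (a∙[a∙b]≡b b a))

  [a∙b]∙a≡b : ∀ a b → (a ∙ b) ∙ a ≡ b
  [a∙b]∙a≡b a b = trans (∙-comm (a ∙ b) a) (a∙[a∙b]≡b a b)

  ∙-cancelˡ : ∀ a {b c} → a ∙ b ≡ a ∙ c → b ≡ c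
  ∙-cancelˡ a {b} {c} eq = trans (sym (a∙[a∙b]≡b a b)) (trans (cong (a ∙_) eq) (a∙[a∙b]≡b a c))

  a∙b≡b∙c⇒a≡c : ∀ {a b c} → a ∙ b ≡ b ∙ c → a ≡ c
  a∙b≡b∙c⇒a≡c {a} {b} eq = ∙-cancelˡ b (trans (∙-comm b a) eq)

  a≡[a∙c]∙[a∙b]⇒a≡b∙c : ∀ {a b c} → a ≡ (a ∙ c) ∙ (a ∙ b) → a ≡ b ∙ c
  a≡[a∙c]∙[a∙b]⇒a≡b∙c {a} {b} {c} eq = trans (sym ([a∙b]∙b≡a a c)) (cong (_∙ c) a∙c≡b)
    where
    open ≡-Reasoning
    a∙c≡b : a ∙ c ≡ b
    a∙c≡b = begin
      a ∙ c                         ≡⟨ sym ([a∙b]∙b≡a (a ∙ c) (a ∙ b)) ⟩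
      ((a ∙ c) ∙ (a ∙ b)) ∙ (a ∙ b) ≡⟨ cong (_∙ (a ∙ b)) (sym eq) ⟩
      a ∙ (a ∙ b)                   ≡⟨ a∙[a∙b]≡b a b ⟩
      b ∎

  derived : Fin n → Fin n → Fin n → Subset n
  derived a b c = triple (a ∙ b) (b ∙ c) (c ∙ a)

  derived-distinct : ∀ {a b c} → Distinct a b c → Distinct (a ∙ b) (b ∙ c) (c ∙ a)
  derived-distinct (a≢b , b≢c , a≢c) = a≢c ∘ a∙b≡b∙c⇒a≡c , ≢-sym a≢b ∘ a∙b≡b∙c⇒a≡c , ≢-sym b≢c ∘ a∙b≡b∙c⇒a≡c ∘ sym

  derived-block : ∀ {a b c} → Distinct a b c → Block (triple a b c) → derived a b c ≡ triple a b c
  derived-block {a} {b} {c} abc@(a≢b , b≢c , a≢c) block = begin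
    triple (a ∙ b) (b ∙ c) (c ∙ a) ≡⟨ cong₂ (λ x y → triple x y (c ∙ a)) (block⇒∙ abc block) (block⇒∙ bca block-bca) ⟩
    triple c a (c ∙ a)             ≡⟨ cong (triple c a) (block⇒∙ cab block-cab) ⟩
    triple c a b                   ≡⟨ sym triple-rotate ⟩
    triple a b c ∎
    where
    open ≡-Reasoning
    bca : Distinct b c a
    bca = b≢c , ≢-sym a≢c , ≢-sym a≢b
    cab : Distinct c a b
    cab = ≢-sym a≢c , a≢b , ≢-sym b≢c
    block-bca : Block (triple b c a)
    block-bca = subst Block (sym triple-rotate) block
    block-cab : Block (triple c a b)
    block-cab = subst Block triple-rotate block

  -- In the Fano plane spanned by a triangle a b c, the points a ∙ b, b ∙ c, c ∙ a form the seventh line.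
  Fano : Set
  Fano = ∀ {a b c} → Distinct a b c → Block (derived a b c)

  ∣derived∣≡3 : ∀ {a b c} → Distinct a b c → ∣ derived a b c ∣ ≡ 3
  ∣derived∣≡3 = ∣triple∣≡3 ∘ derived-distinct

  pairsUnique-⊆Block : ∀ {F : Subset n → Set} → (∀ {T} → F T → Block T) → PairsUnique F
  pairsUnique-⊆Block F⇒Block x≢y FT FT′ = blocks-pairsUnique x≢y (F⇒Block FT) (F⇒Block FT′)

  ∙-distinct : ∀ {x y} → x ≢ y → Distinct x y (x ∙ y)
  ∙-distinct x≢y = let (x∙y≢x , x∙y≢y) , _ = ∙-third x≢y in x≢y , ≢-sym x∙y≢y , ≢-sym x∙y≢x

  block∈B : ∀ {x y} → x ≢ y → InB S (triple x y (x ∙ y))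
  block∈B {x} {y} x≢y = x , y , x ∙ y , ∙-distinct x≢y , sym (derived-block (∙-distinct x≢y) (proj₂ (∙-third x≢y)))

  B-coversPairs : CoversPairs (InB S)
  B-coversPairs x≢y = _ , block∈B x≢y , a∈triple , b∈triple

  Fano⇔B-pairsUnique : Fano ⇔ PairsUnique (InB S)
  Fano⇔B-pairsUnique = mk⇔ Fano⇒B-unique B-unique⇒Fano
    where
    Fano⇒B-unique : Fano → PairsUnique (InB S)
    Fano⇒B-unique fano = pairsUnique-⊆Block λ { (_ , _ , _ , abc , refl) → fano abc }

    B-unique⇒Fano : PairsUnique (InB S) → Fano
    B-unique⇒Fano unique {a} {b} {c} abc =
      subst Block (sym (unique x≢y (a , b , c , abc , refl) (block∈B x≢y) a∈triple b∈triple a∈triple b∈triple))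
            (proj₂ (∙-third x≢y))
      where
      x≢y : a ∙ b ≢ b ∙ c
      x≢y = proj₁ (derived-distinct abc)

  3*β≡nC2⇔Fano : (3 * β S ≡ n C 2) ⇔ Fano
  3*β≡nC2⇔Fano =
    ⇔.trans (3*count≡nC2⇔PairsUnique (InB? S) (λ { (_ , _ , _ , abc , refl) → ∣derived∣≡3 abc }) B-coversPairs)
            (⇔.sym Fano⇔B-pairsUnique)

  apex-triangle : ∀ {x y b} → x ≢ y → b ≢ x → b ≢ y → b ≢ x ∙ y → InA S (derived (b ∙ x) b (b ∙ y))
  apex-triangle {x} {y} {b} x≢y b≢x b≢y b≢x∙y = b ∙ x , b , b ∙ y , distinct , ¬-not ¬block , refl
    where
    distinct : Distinct (b ∙ x) b (b ∙ y)
    distinct = proj₁ (proj₁ (∙-third b≢x)) , ≢-sym (proj₁ (proj₁ (∙-third b≢y))) , x≢y ∘ ∙-cancelˡ b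
    ¬block : ¬ Block (triple (b ∙ x) b (b ∙ y))
    ¬block block = b≢x∙y (begin
      b               ≡⟨ sym ([a∙b]∙b≡a b y) ⟩
      (b ∙ y) ∙ y     ≡⟨ cong (_∙ y) (sym (block⇒∙ distinct block)) ⟩
      (b ∙ x) ∙ b ∙ y ≡⟨ cong (_∙ y) ([a∙b]∙a≡b b x) ⟩
      x ∙ y ∎)
      where open ≡-Reasoning

  x∈apex : ∀ x y b → x ∈ derived (b ∙ x) b (b ∙ y)
  x∈apex x y b = subst (_∈ derived (b ∙ x) b (b ∙ y)) ([a∙b]∙a≡b b x) a∈triple

  y∈apex : ∀ x y b → y ∈ derived (b ∙ x) b (b ∙ y)
  y∈apex x y b = subst (_∈ derived (b ∙ x) b (b ∙ y)) (a∙[a∙b]≡b b y) b∈triple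

  A-coversPairs : 3 < n → CoversPairs (InA S)
  A-coversPairs 3<n {x} {y} x≢y
    with b , _ , b∉ ← ∣q∣<∣p∣⇒∃∈p∉q {p = ⊤} {triple x y (x ∙ y)}
                        (subst₂ _<_ (sym (∣triple∣≡3 (∙-distinct x≢y))) (sym (∣⊤∣≡n n)) 3<n) =
    derived (b ∙ x) b (b ∙ y) ,
    apex-triangle {b = b} x≢y (λ { refl → b∉ a∈triple }) (λ { refl → b∉ b∈triple }) (λ { refl → b∉ c∈triple }) ,
    x∈apex x y b , y∈apex x y b

  -- Unless c ∙ a is the third point of the line through a ∙ b and b ∙ c, the apex triangle at c ∙ a
  -- gives a second member of A(S) through a ∙ b and b ∙ c.
  A-unique⇒triangle-derived-block : PairsUnique (InA S) →
    ∀ {a b c} → Distinct a b c → isBlock (triple a b c) ≡ false → Block (derived a b c)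
  A-unique⇒triangle-derived-block unique {a} {b} {c} abc ¬block = cases (w ≟ᶠ x ∙ y)
    where
    x y w : Fin n
    x = a ∙ b
    y = b ∙ c
    w = c ∙ a
    x≢y : x ≢ y
    x≢y = proj₁ (derived-distinct abc)
    w≢x : w ≢ x
    w≢x = ≢-sym (proj₂ (proj₂ (derived-distinct abc)))
    w≢y : w ≢ y
    w≢y = ≢-sym (proj₁ (proj₂ (derived-distinct abc)))

    w∉apex : w ≢ x ∙ y → w ∉ derived (w ∙ x) w (w ∙ y)
    w∉apex w≢x∙y w∈ with ∈-triple⁻ w∈
    ... | inj₁ w≡ = w≢x (trans w≡ ([a∙b]∙a≡b w x))
    ... | inj₂ (inj₁ w≡) = w≢y (trans w≡ (a∙[a∙b]≡b w y))
    ... | inj₂ (inj₂ w≡) = w≢x∙y (a≡[a∙c]∙[a∙b]⇒a≡b∙c w≡)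

    cases : Dec (w ≡ x ∙ y) → Block (derived a b c)
    cases (yes w≡x∙y) = subst (λ z → Block (triple x y z)) (sym w≡x∙y) (proj₂ (∙-third x≢y))
    cases (no w≢x∙y) = ⊥-elim (w∉apex w≢x∙y (subst (w ∈_) derived≡apex c∈triple))
      where
      derived≡apex : derived a b c ≡ derived (w ∙ x) w (w ∙ y)
      derived≡apex = unique x≢y (a , b , c , abc , ¬block , refl) (apex-triangle {b = w} x≢y w≢x w≢y w≢x∙y)
                            a∈triple b∈triple (x∈apex x y w) (y∈apex x y w)

  Fano⇔A-pairsUnique : Fano ⇔ PairsUnique (InA S)
  Fano⇔A-pairsUnique = mk⇔ Fano⇒A-unique A-unique⇒Fano
    where
    Fano⇒A-unique : Fano → PairsUnique (InA S)
    Fano⇒A-unique fano = pairsUnique-⊆Block λ { (_ , _ , _ , abc , _ , refl) → fano abc }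

    A-unique⇒Fano : PairsUnique (InA S) → Fano
    A-unique⇒Fano unique {a} {b} {c} abc with isBlock (triple a b c) in eq
    ... | true = subst Block (sym (derived-block abc eq)) eq
    ... | false = A-unique⇒triangle-derived-block unique abc eq

  3*α≡nC2⇔Fano : 3 < n → (3 * α S ≡ n C 2) ⇔ Fano
  3*α≡nC2⇔Fano 3<n =
    ⇔.trans (3*count≡nC2⇔PairsUnique (InA? S) (λ { (_ , _ , _ , abc , _ , refl) → ∣derived∣≡3 abc })
                                      (A-coversPairs 3<n))
            (⇔.sym Fano⇔A-pairsUnique)

  IsoPG⇒Fano : ∀ {k} → IsoPG S k → Fano
  IsoPG⇒Fano (f , f-injective , f-point , _ , f-lines) {a} {b} {c} abc@(a≢b , b≢c , a≢c) =
    proj₂ (f-lines (a ∙ b) (b ∙ c) (c ∙ a) x≢y y≢w x≢w) (f-point _ , f-point _ , x≢y ∘ f-injective _ _ , f-sum)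
    where
    open ≡-Reasoning
    x≢y : a ∙ b ≢ b ∙ c
    x≢y = proj₁ (derived-distinct abc)
    y≢w : b ∙ c ≢ c ∙ a
    y≢w = proj₁ (proj₂ (derived-distinct abc))
    x≢w : a ∙ b ≢ c ∙ a
    x≢w = proj₂ (proj₂ (derived-distinct abc))
    f-∙ : ∀ {p q} → p ≢ q → f (p ∙ q) ≡ f p ⊕ f q
    f-∙ {p} {q} p≢q = let p≢q , q≢pq , p≢pq = ∙-distinct p≢q in
      proj₂ (proj₂ (proj₂ (proj₁ (f-lines p q (p ∙ q) p≢q q≢pq p≢pq) (proj₂ (∙-third p≢q)))))
    f-sum : f (c ∙ a) ≡ f (a ∙ b) ⊕ f (b ∙ c)
    f-sum = begin
      f (c ∙ a)                   ≡⟨ f-∙ (≢-sym a≢c) ⟩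
      f c ⊕ f a                   ≡⟨ ⊕-comm (f c) (f a) ⟩
      f a ⊕ f c                   ≡⟨ cong (f a ⊕_) (v⊕[v⊕w]≡w (f b) (f c)) ⟨
      f a ⊕ (f b ⊕ (f b ⊕ f c))   ≡⟨ ⊕-assoc (f a) (f b) (f b ⊕ f c) ⟨
      (f a ⊕ f b) ⊕ (f b ⊕ f c)   ≡⟨ cong₂ _⊕_ (f-∙ a≢b) (f-∙ b≢c) ⟨
      f (a ∙ b) ⊕ f (b ∙ c) ∎

-- The Boolean group of a Fano Steiner triple system

module BooleanGroup {n : ℕ} (S : STS n) (fano : Steiner.Fano S) where
  open STS S
  open Steiner S

  -- The Fano property for the triangle a ∙ b, b, c.
  ∙-assoc : ∀ {a b c} → a ≢ b → b ≢ c → a ∙ b ≢ c → (a ∙ b) ∙ c ≡ a ∙ (b ∙ c)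
  ∙-assoc {a} {b} {c} a≢b b≢c a∙b≢c = begin
    (a ∙ b) ∙ c             ≡⟨ ∙-comm (a ∙ b) c ⟩
    c ∙ (a ∙ b)             ≡⟨ block⇒∙ (derived-distinct xbc) (fano xbc) ⟨
    ((a ∙ b) ∙ b) ∙ (b ∙ c) ≡⟨ cong (_∙ (b ∙ c)) ([a∙b]∙b≡a a b) ⟩
    a ∙ (b ∙ c) ∎
    where
    open ≡-Reasoning
    xbc : Distinct (a ∙ b) b c
    xbc = proj₂ (proj₁ (∙-third a≢b)) , b≢c , a∙b≢c

  G : Set
  G = Maybe (Fin n)

  infixl 6 _⊞_
  _⊞_ : G → G → G
  nothing ⊞ h = h
  just a ⊞ nothing = just a
  just a ⊞ just b = if does (a ≟ᶠ b) then nothing else just (a ∙ b)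

  just⊞just : ∀ {a b} → a ≢ b → just a ⊞ just b ≡ just (a ∙ b)
  just⊞just {a} {b} a≢b rewrite dec-false (a ≟ᶠ b) a≢b = refl

  ⊞-identityʳ : ∀ g → g ⊞ nothing ≡ g
  ⊞-identityʳ nothing = refl
  ⊞-identityʳ (just a) = refl

  ⊞-self : ∀ g → g ⊞ g ≡ nothing
  ⊞-self nothing = refl
  ⊞-self (just a) rewrite dec-true (a ≟ᶠ a) refl = refl

  ⊞-comm : ∀ g h → g ⊞ h ≡ h ⊞ g
  ⊞-comm nothing h = sym (⊞-identityʳ h)
  ⊞-comm (just a) nothing = refl
  ⊞-comm (just a) (just b) = ≟-cases {λ a b → just a ⊞ just b ≡ just b ⊞ just a} (λ _ → refl)
    (λ {a} {b} a≢b → trans (just⊞just a≢b) (trans (cong just (∙-comm a b)) (sym (just⊞just (≢-sym a≢b))))) a b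

  just⊞[just⊞g]≡g : ∀ a g → just a ⊞ (just a ⊞ g) ≡ g
  just⊞[just⊞g]≡g a nothing = ⊞-self (just a)
  just⊞[just⊞g]≡g a (just b) =
    ≟-cases {λ a b → just a ⊞ (just a ⊞ just b) ≡ just b} (λ a → cong (just a ⊞_) (⊞-self (just a)))
    (λ {a} {b} a≢b → trans (cong (just a ⊞_) (just⊞just a≢b))
                           (trans (just⊞just (proj₂ (proj₂ (∙-distinct a≢b)))) (cong just (a∙[a∙b]≡b a b)))) a b

  ⊞-assoc-distinct : ∀ {a b c} → a ≢ b → b ≢ c → (just a ⊞ just b) ⊞ just c ≡ just a ⊞ (just b ⊞ just c)
  ⊞-assoc-distinct {a} {b} {c} a≢b b≢c = begin
    (just a ⊞ just b) ⊞ just c ≡⟨ cong (_⊞ just c) (just⊞just a≢b) ⟩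
    just (a ∙ b) ⊞ just c      ≡⟨ cases (a ∙ b ≟ᶠ c) ⟩
    just a ⊞ just (b ∙ c)      ≡⟨ cong (just a ⊞_) (just⊞just b≢c) ⟨
    just a ⊞ (just b ⊞ just c) ∎
    where
    open ≡-Reasoning
    cases : Dec (a ∙ b ≡ c) → just (a ∙ b) ⊞ just c ≡ just a ⊞ just (b ∙ c)
    cases (yes refl) = begin
      just (a ∙ b) ⊞ just (a ∙ b) ≡⟨ ⊞-self (just (a ∙ b)) ⟩
      nothing                     ≡⟨ ⊞-self (just a) ⟨
      just a ⊞ just a             ≡⟨ cong (λ x → just a ⊞ just x) (trans (∙-comm b (a ∙ b)) ([a∙b]∙b≡a a b)) ⟨
      just a ⊞ just (b ∙ (a ∙ b)) ∎
    cases (no a∙b≢c) = begin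
      just (a ∙ b) ⊞ just c ≡⟨ just⊞just a∙b≢c ⟩
      just ((a ∙ b) ∙ c)    ≡⟨ cong just (∙-assoc a≢b b≢c a∙b≢c) ⟩
      just (a ∙ (b ∙ c))    ≡⟨ just⊞just a≢b∙c ⟨
      just a ⊞ just (b ∙ c) ∎
      where
      a≢b∙c : a ≢ b ∙ c
      a≢b∙c a≡b∙c = a∙b≢c (trans (cong (_∙ b) a≡b∙c) ([a∙b]∙a≡b b c))

  ⊞-assoc : ∀ g h k → (g ⊞ h) ⊞ k ≡ g ⊞ (h ⊞ k)
  ⊞-assoc nothing h k = refl
  ⊞-assoc (just a) nothing k = refl
  ⊞-assoc (just a) (just b) nothing = ⊞-identityʳ (just a ⊞ just b)
  ⊞-assoc (just a) (just b) (just c) = cases (a ≟ᶠ b) (b ≟ᶠ c) (a ≟ᶠ c)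
    where
    open ≡-Reasoning
    cases : Dec (a ≡ b) → Dec (b ≡ c) → Dec (a ≡ c) → (just a ⊞ just b) ⊞ just c ≡ just a ⊞ (just b ⊞ just c)
    cases (yes refl) _ _ = trans (cong (_⊞ just c) (⊞-self (just a))) (sym (just⊞[just⊞g]≡g a (just c)))
    cases _ (yes refl) _ = begin
      (just a ⊞ just b) ⊞ just b ≡⟨ ⊞-comm (just a ⊞ just b) (just b) ⟩
      just b ⊞ (just a ⊞ just b) ≡⟨ cong (just b ⊞_) (⊞-comm (just a) (just b)) ⟩
      just b ⊞ (just b ⊞ just a) ≡⟨ just⊞[just⊞g]≡g b (just a) ⟩
      just a                     ≡⟨ cong (just a ⊞_) (⊞-self (just b)) ⟨
      just a ⊞ (just b ⊞ just b) ∎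
    cases _ _ (yes refl) = trans (⊞-comm (just a ⊞ just b) (just a)) (cong (just a ⊞_) (⊞-comm (just a) (just b)))
    cases (no a≢b) (no b≢c) (no _) = ⊞-assoc-distinct a≢b b≢c

  g⊞[g⊞h]≡h : ∀ g h → g ⊞ (g ⊞ h) ≡ h
  g⊞[g⊞h]≡h g h = trans (sym (⊞-assoc g g h)) (cong (_⊞ h) (⊞-self g))

  ⊞-cancelˡ : ∀ g {h k} → g ⊞ h ≡ g ⊞ k → h ≡ k
  ⊞-cancelˡ g {h} {k} eq = trans (sym (g⊞[g⊞h]≡h g h)) (trans (cong (g ⊞_) eq) (g⊞[g⊞h]≡h g k))

  ⊞-interchange : ∀ g h k l → (g ⊞ h) ⊞ (k ⊞ l) ≡ (g ⊞ k) ⊞ (h ⊞ l)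
  ⊞-interchange g h k l = begin
    (g ⊞ h) ⊞ (k ⊞ l) ≡⟨ ⊞-assoc g h (k ⊞ l) ⟩
    g ⊞ (h ⊞ (k ⊞ l)) ≡⟨ cong (g ⊞_) (⊞-assoc h k l) ⟨
    g ⊞ ((h ⊞ k) ⊞ l) ≡⟨ cong (λ x → g ⊞ (x ⊞ l)) (⊞-comm h k) ⟩
    g ⊞ ((k ⊞ h) ⊞ l) ≡⟨ cong (g ⊞_) (⊞-assoc k h l) ⟩
    g ⊞ (k ⊞ (h ⊞ l)) ≡⟨ ⊞-assoc g k (h ⊞ l) ⟨
    (g ⊞ k) ⊞ (h ⊞ l) ∎
    where open ≡-Reasoning

  record LinearEmbedding (m : ℕ) : Set where
    field
      embed           : Vec Bool m → G
      embed-⊕         : ∀ v w → embed (v ⊕ w) ≡ embed v ⊞ embed w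
      embed-injective : Injective _≡_ _≡_ embed

  open LinearEmbedding

  Onto : ∀ {m} → LinearEmbedding m → Set
  Onto E = ∀ g → ∃ λ v → embed E v ≡ g

  embed-0 : ∀ {m} (E : LinearEmbedding m) → embed E (replicate m false) ≡ nothing
  embed-0 {m} E = begin
    embed E 0ᵛ                  ≡⟨ cong (embed E) (⊕-self 0ᵛ) ⟨
    embed E (0ᵛ ⊕ 0ᵛ)           ≡⟨ embed-⊕ E 0ᵛ 0ᵛ ⟩
    embed E 0ᵛ ⊞ embed E 0ᵛ     ≡⟨ ⊞-self (embed E 0ᵛ) ⟩
    nothing ∎
    where
    open ≡-Reasoning
    0ᵛ : Vec Bool m
    0ᵛ = replicate m false

  trivialEmbedding : LinearEmbedding 0
  trivialEmbedding = record
    { embed = λ _ → nothing ; embed-⊕ = λ { [] [] → refl } ; embed-injective = λ { {[]} {[]} _ → refl } }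

  extend : ∀ {m} (E : LinearEmbedding m) (g : G) → (∀ v → embed E v ≢ g) → LinearEmbedding (suc m)
  extend {m} E g g∉E = record { embed = embed′ ; embed-⊕ = embed′-⊕ ; embed-injective = embed′-injective }
    where
    scale : Bool → G
    scale b = if b then g else nothing

    scale-xor : ∀ b b′ → scale (b xor b′) ≡ scale b ⊞ scale b′
    scale-xor true true = sym (⊞-self g)
    scale-xor true false = sym (⊞-identityʳ g)
    scale-xor false b′ = refl

    embed′ : Vec Bool (suc m) → G
    embed′ (b ∷ v) = scale b ⊞ embed E v

    embed′-⊕ : ∀ v w → embed′ (v ⊕ w) ≡ embed′ v ⊞ embed′ w
    embed′-⊕ (b ∷ v) (b′ ∷ w) =
      trans (cong₂ _⊞_ (scale-xor b b′) (embed-⊕ E v w)) (⊞-interchange (scale b) (scale b′) (embed E v) (embed E w))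

    g⊞E≢E : ∀ v w → g ⊞ embed E v ≢ embed E w
    g⊞E≢E v w eq = g∉E (w ⊕ v) (begin
      embed E (w ⊕ v)             ≡⟨ embed-⊕ E w v ⟩
      embed E w ⊞ embed E v       ≡⟨ cong (_⊞ embed E v) eq ⟨
      g ⊞ embed E v ⊞ embed E v   ≡⟨ ⊞-comm (g ⊞ embed E v) (embed E v) ⟩
      embed E v ⊞ (g ⊞ embed E v) ≡⟨ cong (embed E v ⊞_) (⊞-comm g (embed E v)) ⟩
      embed E v ⊞ (embed E v ⊞ g) ≡⟨ g⊞[g⊞h]≡h (embed E v) g ⟩
      g ∎)
      where open ≡-Reasoning

    embed′-injective : Injective _≡_ _≡_ embed′
    embed′-injective {false ∷ v} {false ∷ w} eq = cong (false ∷_) (embed-injective E eq)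
    embed′-injective {true ∷ v}  {true ∷ w}  eq = cong (true ∷_) (embed-injective E (⊞-cancelˡ g eq))
    embed′-injective {true ∷ v}  {false ∷ w} eq = ⊥-elim (g⊞E≢E v w eq)
    embed′-injective {false ∷ v} {true ∷ w}  eq = ⊥-elim (g⊞E≢E w v (sym eq))

  dimension≤n : ∀ {m} → LinearEmbedding m → m ≤ n
  dimension≤n E = ≤-pred (injective⇒≤ {f = toFinᵐ ∘ embed E ∘ thermometer}
                                      (thermometer-injective ∘ embed-injective E ∘ toFinᵐ-injective))

  -- Vec Bool m is Subset m, so anySubset? searches all vectors.
  image? : ∀ {m} (E : LinearEmbedding m) g → Dec (∃ λ v → embed E v ≡ g)
  image? E g = anySubset? (λ v → ≡-decᵐ _≟ᶠ_ (embed E v) g)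

  -- The fuel only ensures termination: by dimension≤n it never runs out.
  extend-until-onto : ∀ {m} (E : LinearEmbedding m) fuel → n < m + fuel → ∃ λ k → Σ (LinearEmbedding k) Onto
  extend-until-onto {m} E zero n<m+0 = ⊥-elim (<⇒≱ (subst (n <_) (+-identityʳ m) n<m+0) (dimension≤n E))
  extend-until-onto {m} E (suc fuel) n<m+fuel with any? (λ a → ¬? (image? E (just a)))
  ... | yes (a , a∉E) =
    extend-until-onto (extend E (just a) (λ v eq → a∉E (v , eq))) fuel (subst (n <_) (+-suc m fuel) n<m+fuel)
  ... | no ¬a∉E = m , E , onto
    where
    onto : Onto E
    onto nothing = _ , embed-0 E
    onto (just a) = decidable-stable (image? E (just a)) (λ a∉E → ¬a∉E (a , a∉E))

  ontoEmbedding : ∃ λ m → Σ (LinearEmbedding m) Onto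
  ontoEmbedding = extend-until-onto trivialEmbedding (suc n) ≤-refl

  onto⇒3≤dimension : 3 < n → ∀ {m} (E : LinearEmbedding m) → Onto E → 3 ≤ m
  onto⇒3≤dimension 3<n {m} E onto with 3 ≤? m
  ... | yes 3≤m = 3≤m
  ... | no 3≰m = ⊥-elim (<⇒≱ ≤-refl (≤-trans (s≤s 3<n) (≤-trans suc-n≤2^m 2^m≤4)))
    where
    section : G → Vec Bool m
    section g = proj₁ (onto g)
    section-injective : Injective _≡_ _≡_ section
    section-injective {g} {h} eq = trans (sym (proj₂ (onto g))) (trans (cong (embed E) eq) (proj₂ (onto h)))
    suc-n≤2^m : suc n ≤ 2 ^ m
    suc-n≤2^m = injective⇒≤ {f = binary ∘ section ∘ fromFinᵐ}
                            (fromFinᵐ-injective ∘ section-injective ∘ binary-injective)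
    2^m≤4 : 2 ^ m ≤ 4
    2^m≤4 = ^-monoʳ-≤ 2 (≤-pred (≰⇒> 3≰m))

  onto⇒IsoPG : ∀ {k} (E : LinearEmbedding (suc k)) → Onto E → IsoPG S k
  onto⇒IsoPG {k} E onto = f , f-injective , f-point , f-onto , f-lines
    where
    f : Fin n → Vec Bool (suc k)
    f a = proj₁ (onto (just a))

    embed-f : ∀ a → embed E (f a) ≡ just a
    embed-f a = proj₂ (onto (just a))

    f-injective : ∀ a b → f a ≡ f b → a ≡ b
    f-injective a b eq = just-injective (trans (sym (embed-f a)) (trans (cong (embed E) eq) (embed-f b)))

    f-point : ∀ a → PGPoint k (f a)
    f-point a f≡0 with () ← trans (sym (embed-f a)) (trans (cong (embed E) f≡0) (embed-0 E))

    f-onto : ∀ v → PGPoint k v → ∃ λ a → f a ≡ v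
    f-onto v v≢0 with embed E v in eq
    ... | nothing = ⊥-elim (v≢0 (embed-injective E (trans eq (sym (embed-0 E)))))
    ... | just a = a , embed-injective E (trans (embed-f a) (sym eq))

    embed-f⊕f : ∀ {a b} → a ≢ b → embed E (f a ⊕ f b) ≡ just (a ∙ b)
    embed-f⊕f {a} {b} a≢b = trans (embed-⊕ E (f a) (f b)) (trans (cong₂ _⊞_ (embed-f a) (embed-f b)) (just⊞just a≢b))

    f-lines : ∀ a b c → a ≢ b → b ≢ c → a ≢ c →
              (Block (triple a b c) → PGLine k (f a) (f b) (f c)) × (PGLine k (f a) (f b) (f c) → Block (triple a b c))
    f-lines a b c a≢b b≢c a≢c = block⇒line , line⇒block
      where
      block⇒line : Block (triple a b c) → PGLine k (f a) (f b) (f c)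
      block⇒line block = f-point a , f-point b , a≢b ∘ f-injective a b ,
        embed-injective E (trans (embed-f c)
                                 (trans (cong just (sym (block⇒∙ (a≢b , b≢c , a≢c) block))) (sym (embed-f⊕f a≢b))))

      line⇒block : PGLine k (f a) (f b) (f c) → Block (triple a b c)
      line⇒block (_ , _ , _ , fc≡fa⊕fb) = subst (λ z → Block (triple a b z)) (sym c≡a∙b) (proj₂ (∙-third a≢b))
        where
        c≡a∙b : c ≡ a ∙ b
        c≡a∙b = just-injective (trans (sym (embed-f c)) (trans (cong (embed E) fc≡fa⊕fb) (embed-f⊕f a≢b)))

  Fano⇒IsoPG : 3 < n → ∃ λ k → k ≥ 2 × IsoPG S k
  Fano⇒IsoPG 3<n with ontoEmbedding
  ... | zero , E , onto with () ← onto⇒3≤dimension 3<n E onto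
  ... | suc k , E , onto = k , ≤-pred (onto⇒3≤dimension 3<n E onto) , onto⇒IsoPG E onto

Fano⇔IsoPG : ∀ {n} → 3 < n → (S : STS n) → Steiner.Fano S ⇔ (∃ λ k → k ≥ 2 × IsoPG S k)
Fano⇔IsoPG 3<n S = mk⇔ Fano⇒PG (λ (_ , _ , iso) → Steiner.IsoPG⇒Fano S iso)
  where
  Fano⇒PG : Steiner.Fano S → ∃ λ k → k ≥ 2 × IsoPG S k
  Fano⇒PG fano = BooleanGroup.Fano⇒IsoPG S fano 3<n

proposition2p2 : (n : ℕ) → n > 3 → (S : STS n) →
    ((3 * β S ≡ n C 2) ⇔ (3 * α S ≡ n C 2)) ×
    ((3 * α S ≡ n C 2) ⇔ (∃ λ k → k ≥ 2 × IsoPG S k))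
proposition2p2 n 3<n S =
  ⇔.trans 3*β≡nC2⇔Fano (⇔.sym (3*α≡nC2⇔Fano 3<n)) ,
  ⇔.trans (3*α≡nC2⇔Fano 3<n) (Fano⇔IsoPG 3<n S)
  where open Steiner S
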